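{- Let $\lambda,\mu,\nu$ be partitions with $|\nu|=|\lambda|+|\mu|$. (1) If $\nu_1-\nu_2\ge|\lambda|$, then $c_{\lambda,\mu}^{\nu}=c_{\lambda,\mu^+}^{\nu^+}$. (2) If $\mu_1-\mu_2\ge|\lambda|$, then $c_{\lambda,\mu}^{\nu}=c_{\lambda,\mu^+}^{\nu^+}$.
   Context: $c_{\lambda,\mu}^{\nu}$ denotes the Littlewood–Richardson coefficient. For a partition $\lambda$, $\lambda^+=(\lambda_1+1,\lambda_2,\lambda_3,\dots)$. -}

module Defs where

open import Data.Nat using (ℕ; zero; suc; _+_; _∸_; _≤_; _<_; _≤ᵇ_; _<ᵇ_; _≡ᵇ_)
open import Data.Bool using (Bool; true; false; _∧_; _∨_; not; if_then_else_)
open import Data.List using (List; []; _∷_; length; map; concatMap; concat; reverse; filter; upTo; foldr)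
open import Data.Nat.ListAction using (sum)
open import Data.List.Relation.Unary.All using (All)
open import Data.List.Relation.Unary.Linked using (Linked)
open import Data.Maybe using (Maybe; just; nothing)

IsPartition : List ℕ → Set
IsPartition p = Linked (λ a b → b ≤ a) p × All (λ a → 0 < a) p
  where open import Data.Product using (_×_)

size : List ℕ → ℕ
size = sum

-- part p i = λ_{i+1}  (0-indexed; 0 beyond the length)
part : List ℕ → ℕ → ℕ
part []       _       = 0
part (x ∷ xs) zero    = x
part (x ∷ xs) (suc i) = part xs i

-- λ⁺ = (λ₁+1, λ₂, λ₃, …)   (for λ = ∅ this is (1))
plus : List ℕ → List ℕ
plus []       = 1 ∷ []
plus (x ∷ xs) = suc x ∷ xs

-- Littlewood–Richardson coefficients, via LR tableaux.
-- c^ν_{λ,μ} = number of fillings T of the skew shape ν/λ by positive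
-- integers such that rows weakly increase, columns strictly increase,
-- the content is μ, and the reverse reading word (rows read right to
-- left, top to bottom) is a lattice word.

-- A filling is a list of rows; row r (0-indexed) holds the entries of
-- columns part λ r, …, part ν r ∸ 1 (0-indexed columns), left to right.

nth : {A : Set} → List A → ℕ → Maybe A
nth []       _       = nothing
nth (x ∷ xs) zero    = just x
nth (x ∷ xs) (suc i) = nth xs i

allB : {A : Set} → (A → Bool) → List A → Bool
allB f = foldr (λ a b → f a ∧ b) true

range : ℕ → ℕ → List ℕ
range lo hi = map (λ k → lo + k) (upTo (hi ∸ lo))

words : ℕ → ℕ → List (List ℕ)
words zero    m = [] ∷ []
words (suc k) m = concatMap (λ a → map (a ∷_) (words k m)) (map suc (upTo m))

candidatesFrom : List ℕ → List ℕ → ℕ → ℕ → ℕ → List (List (List ℕ))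
candidatesFrom lam nu m r zero    = [] ∷ []
candidatesFrom lam nu m r (suc k) =
  concatMap (λ row → map (row ∷_) (candidatesFrom lam nu m (suc r) k))
            (words (part nu r ∸ part lam r) m)

candidates : List ℕ → List ℕ → ℕ → List (List (List ℕ))
candidates lam nu m = candidatesFrom lam nu m 0 (length nu)

-- entry of T in row r, column j (absolute, 0-indexed)
entry : List ℕ → List (List ℕ) → ℕ → ℕ → Maybe ℕ
entry lam T r j with nth T r
... | nothing  = nothing
... | just row = if part lam r ≤ᵇ j then nth row (j ∸ part lam r) else nothing

ltM : Maybe ℕ → Maybe ℕ → Bool
ltM (just a) (just b) = a <ᵇ b
ltM _        _        = false

rowWeak : List ℕ → Bool
rowWeak []           = true
rowWeak (a ∷ [])     = true
rowWeak (a ∷ b ∷ xs) = (a ≤ᵇ b) ∧ rowWeak (b ∷ xs)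

rowsWeak : List (List ℕ) → Bool
rowsWeak = allB rowWeak

colsStrict : List ℕ → List ℕ → List (List ℕ) → Bool
colsStrict lam nu T =
  allB (λ r → allB (λ j → if (part lam r ≤ᵇ j) ∧ (j <ᵇ part nu r)
                             then ltM (entry lam T r j) (entry lam T (suc r) j)
                             else true)
                   (range (part lam (suc r)) (part nu (suc r))))
       (upTo (length nu))

count : ℕ → List ℕ → ℕ
count i []       = 0
count i (x ∷ xs) = if i ≡ᵇ x then suc (count i xs) else count i xs

-- content of T equals μ (entries are already in {1,…,ℓ(μ)})
contentIs : List ℕ → List (List ℕ) → Bool
contentIs mu T = allB (λ i → count (suc i) (concat T) ≡ᵇ part mu i) (upTo (length mu))

prefixes : List ℕ → List (List ℕ)
prefixes []       = [] ∷ []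
prefixes (x ∷ xs) = [] ∷ map (x ∷_) (prefixes xs)

lattice : ℕ → List ℕ → Bool
lattice m w = allB (λ p → allB (λ i → count (suc (suc i)) p ≤ᵇ count (suc i) p) (upTo m))
                   (prefixes w)

reverseReading : List (List ℕ) → List ℕ
reverseReading T = concat (map reverse T)

containedB : List ℕ → List ℕ → Bool
containedB lam nu = (length lam ≤ᵇ length nu) ∧ allB (λ r → part lam r ≤ᵇ part nu r) (upTo (length nu))

isLR : List ℕ → List ℕ → List ℕ → List (List ℕ) → Bool
isLR lam mu nu T = rowsWeak T ∧ colsStrict lam nu T ∧ contentIs mu T
                   ∧ lattice (length mu) (reverseReading T)

-- LR λ μ ν = c^ν_{λ,μ}
LR : List ℕ → List ℕ → List ℕ → ℕ
LR lam mu nu = if containedB lam nu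
               then length (filter (λ T → Data.Bool.T? (isLR lam mu nu T)) (candidates lam nu (length mu)))
               else 0
  where import Data.Bool

-- In an LR tableau of shape ν/λ the first row is weakly increasing and its last entry begins the
-- reverse reading word, so the row is 11…1, of length k = ν₁ − λ₁.  Lengthening it by one 1 matches
-- the LR tableaux for (λ, μ, ν) with those for (λ, μ⁺, ν⁺): semistandardness and the content shift
-- from μ to μ⁺ are automatic, and the lattice property is unaffected as long as the rows below hold
-- at most k 2s.  By column strictness, the entries v+1 strictly below row r number at most λ_r plus
-- the entries ≤ v of row r.  Under (1) this bounds the 2s by max(λ₂, ν₂) ≤ k.  Under (2) it bounds
-- the 1s below the first row by λ₁, so k ≥ μ₁ − λ₁ ≥ μ₂, and μ₂ bounds the 2s.  When λ₁ > ν₁ both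
-- coefficients vanish, the case λ₁ = ν₁ + 1 by the same count of 1s.

module Submission where

open import Defs
open import Data.Nat using (ℕ; _+_; _∸_; _≤_)
open import Data.List using (List)
open import Data.Product using (_×_)
open import Relation.Binary.PropositionalEquality using (_≡_)

open import Data.Nat using (zero; suc; _<_; _≤ᵇ_; _<ᵇ_; _≡ᵇ_; z≤n; s≤s)
open import Data.Nat.Properties
open import Data.Nat.ListAction using (sum)
open import Data.Nat.ListAction.Properties using (sum-++)
open import Data.Bool using (Bool; true; false; T; _∧_; if_then_else_; T?)
open import Data.Bool.Properties using (∧-zeroʳ; ∧-conicalˡ; ∧-conicalʳ; T-≡; if-cong; if-cong-then; if-eta)
open import Data.List using ([]; _∷_; length; map; concatMap; concat; reverse; filter; upTo; applyUpTo; replicate; _++_; drop; [_]; _∷ʳ_)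
open import Data.List.Properties using (map-∘; map-++; length-++; length-replicate; filter-++; filter-none; unfold-reverse)
open import Data.List.Membership.Propositional using (_∈_; find)
open import Data.List.Membership.Propositional.Properties using (∈-map⁻; ∈-map⁺; ∈-upTo⁺; ∈-upTo⁻; ∈-applyUpTo⁻; ∈-concatMap⁻)
open import Data.List.Relation.Unary.Any using (Any; here; there)
open import Data.List.Relation.Unary.All as All using (All; []; _∷_)
open import Data.List.Relation.Unary.All.Properties using (replicate⁺)
open import Data.List.Relation.Unary.Linked using ([]; [-]; _∷_)
open import Data.Maybe using (just; nothing)
open import Data.Product using (Σ; _,_; proj₁; proj₂)
open import Data.Sum using (_⊎_; inj₁; inj₂)
open import Data.Empty using (⊥; ⊥-elim)
open import Function using (_∘_; Equivalence)
open import Relation.Binary.PropositionalEquality using (refl; sym; trans; cong; cong₂; subst; module ≡-Reasoning)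
open import Algebra.Properties.CommutativeSemigroup +-commutativeSemigroup using (x∙yz≈y∙xz)
open import Relation.Binary.Definitions using (tri<; tri≈; tri>)
open import Relation.Nullary using (¬_; yes; no)

≤⇒≤ᵇ≡true : ∀ {m n} → m ≤ n → (m ≤ᵇ n) ≡ true
≤⇒≤ᵇ≡true m≤n = Equivalence.to T-≡ (≤⇒≤ᵇ m≤n)

≤ᵇ≡true⇒≤ : ∀ {m n} → (m ≤ᵇ n) ≡ true → m ≤ n
≤ᵇ≡true⇒≤ {m} {n} eq = ≤ᵇ⇒≤ m n (Equivalence.from T-≡ eq)

≤ᵇ≡false⇒> : ∀ {m n} → (m ≤ᵇ n) ≡ false → n < m
≤ᵇ≡false⇒> eq = ≰⇒> (λ m≤n → subst T eq (≤⇒≤ᵇ m≤n))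

>⇒≤ᵇ≡false : ∀ {m n} → n < m → (m ≤ᵇ n) ≡ false
>⇒≤ᵇ≡false {m} {n} n<m with m ≤ᵇ n in eq
... | false = refl
... | true  = ⊥-elim (<⇒≱ n<m (≤ᵇ≡true⇒≤ eq))

<⇒<ᵇ≡true : ∀ {m n} → m < n → (m <ᵇ n) ≡ true
<⇒<ᵇ≡true = ≤⇒≤ᵇ≡true

<ᵇ≡true⇒< : ∀ {m n} → (m <ᵇ n) ≡ true → m < n
<ᵇ≡true⇒< = ≤ᵇ≡true⇒≤

≡ᵇ-refl : ∀ n → (n ≡ᵇ n) ≡ true
≡ᵇ-refl zero    = refl
≡ᵇ-refl (suc n) = ≡ᵇ-refl n

≡ᵇ≡true⇒≡ : ∀ {m n} → (m ≡ᵇ n) ≡ true → m ≡ n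
≡ᵇ≡true⇒≡ {m} {n} eq = ≡ᵇ⇒≡ m n (Equivalence.from T-≡ eq)

≢⇒≡ᵇ≡false : ∀ {m n} → ¬ m ≡ n → (m ≡ᵇ n) ≡ false
≢⇒≡ᵇ≡false {m} {n} m≢n with m ≡ᵇ n in eq
... | false = refl
... | true  = ⊥-elim (m≢n (≡ᵇ≡true⇒≡ eq))

allB-∈ : {A : Set} (f : A → Bool) (xs : List A) → allB f xs ≡ true → ∀ {x} → x ∈ xs → f x ≡ true
allB-∈ f (y ∷ ys) h (here refl) = ∧-conicalˡ _ _ h
allB-∈ f (y ∷ ys) h (there p)   = allB-∈ f ys (∧-conicalʳ (f y) _ h) p

allB-cong : {A : Set} (f g : A → Bool) (xs : List A) → (∀ {x} → x ∈ xs → f x ≡ g x) → allB f xs ≡ allB g xs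
allB-cong f g []       h = refl
allB-cong f g (y ∷ ys) h = cong₂ _∧_ (h (here refl)) (allB-cong f g ys (h ∘ there))

allB-false : {A : Set} (f : A → Bool) (xs : List A) → ∀ {x} → x ∈ xs → f x ≡ false → allB f xs ≡ false
allB-false f (y ∷ ys) (here refl) fy≡false = cong (_∧ allB f ys) fy≡false
allB-false f (y ∷ ys) (there p)   fx≡false =
  trans (cong (f y ∧_) (allB-false f ys p fx≡false)) (∧-zeroʳ (f y))

allB-map : {A B : Set} (f : B → Bool) (g : A → B) (xs : List A) → allB f (map g xs) ≡ allB (f ∘ g) xs
allB-map f g []       = refl
allB-map f g (x ∷ xs) = cong (f (g x) ∧_) (allB-map f g xs)

allB-true : {A : Set} (f : A → Bool) (xs : List A) → (∀ x → f x ≡ true) → allB f xs ≡ true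
allB-true f []       h = refl
allB-true f (x ∷ xs) h rewrite h x = allB-true f xs h

countBy : {A : Set} → (A → Bool) → List A → ℕ
countBy p xs = length (filter (T? ∘ p) xs)

countBy-++ : {A : Set} (p : A → Bool) (xs ys : List A) → countBy p (xs ++ ys) ≡ countBy p xs + countBy p ys
countBy-++ p xs ys = trans (cong length (filter-++ (T? ∘ p) xs ys)) (length-++ (filter (T? ∘ p) xs))

countBy-concatMap : {A B : Set} (p : B → Bool) (g : A → List B) (xs : List A) →
  countBy p (concatMap g xs) ≡ sum (map (countBy p ∘ g) xs)
countBy-concatMap p g []       = refl
countBy-concatMap p g (x ∷ xs) =
  trans (countBy-++ p (g x) (concatMap g xs)) (cong (countBy p (g x) +_) (countBy-concatMap p g xs))

countBy-map : {A B : Set} (p : B → Bool) (f : A → B) (xs : List A) → countBy p (map f xs) ≡ countBy (p ∘ f) xs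
countBy-map p f []       = refl
countBy-map p f (x ∷ xs) with p (f x)
... | true  = cong suc (countBy-map p f xs)
... | false = countBy-map p f xs

countBy-cong : {A : Set} (p q : A → Bool) (xs : List A) → (∀ {x} → x ∈ xs → p x ≡ q x) → countBy p xs ≡ countBy q xs
countBy-cong p q []       h = refl
countBy-cong p q (x ∷ xs) h with p x | q x | h (here refl)
... | true  | .true  | refl = cong suc (countBy-cong p q xs (h ∘ there))
... | false | .false | refl = countBy-cong p q xs (h ∘ there)

countBy-none : {A : Set} (p : A → Bool) (xs : List A) → (∀ x → p x ≡ false) → countBy p xs ≡ 0
countBy-none p xs h = cong length (filter-none (T? ∘ p) {xs} (All.tabulate (λ {x} _ → subst T (h x))))

sum-map-zero : {A : Set} (f : A → ℕ) (xs : List A) → (∀ {x} → x ∈ xs → f x ≡ 0) → sum (map f xs) ≡ 0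
sum-map-zero f []       h = refl
sum-map-zero f (x ∷ xs) h rewrite h (here refl) = sum-map-zero f xs (h ∘ there)

sum-map-concatMap : {A B : Set} (c : B → ℕ) (g : A → List B) (xs : List A) →
  sum (map c (concatMap g xs)) ≡ sum (map (λ a → sum (map c (g a))) xs)
sum-map-concatMap c g []       = refl
sum-map-concatMap c g (x ∷ xs) = begin
  sum (map c (g x ++ concatMap g xs))                         ≡⟨ cong sum (map-++ c (g x) (concatMap g xs)) ⟩
  sum (map c (g x) ++ map c (concatMap g xs))                 ≡⟨ sum-++ (map c (g x)) _ ⟩
  sum (map c (g x)) + sum (map c (concatMap g xs))            ≡⟨ cong (sum (map c (g x)) +_) (sum-map-concatMap c g xs) ⟩
  sum (map c (g x)) + sum (map (λ a → sum (map c (g a))) xs)  ∎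
  where open ≡-Reasoning

∈-concatMap-∷⁻ : {A : Set} (xs : List A) (yss : List (List A)) {zs : List A} →
  zs ∈ concatMap (λ x → map (x ∷_) yss) xs → Σ A λ x → Σ (List A) λ ys → zs ≡ x ∷ ys × x ∈ xs × ys ∈ yss
∈-concatMap-∷⁻ xs yss p with find (∈-concatMap⁻ (λ x → map (x ∷_) yss) {xs = xs} p)
... | x , x∈ , zs∈ with ∈-map⁻ (x ∷_) zs∈
... | ys , ys∈ , refl = x , ys , refl , x∈ , ys∈

∈-words⁻ : ∀ k m {w} → w ∈ words (suc k) m →
  Σ ℕ λ a → Σ (List ℕ) λ w′ → w ≡ a ∷ w′ × a ≤ m × w′ ∈ words k m
∈-words⁻ k m p with ∈-concatMap-∷⁻ (map suc (upTo m)) (words k m) p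
... | a , w′ , refl , a∈ , w′∈ with ∈-map⁻ suc a∈
... | i , i∈ , refl = suc i , w′ , refl , ∈-upTo⁻ i∈ , w′∈

∈-words⇒length : ∀ k m {w} → w ∈ words k m → length w ≡ k
∈-words⇒length zero    m (here refl) = refl
∈-words⇒length (suc k) m p with ∈-words⁻ k m p
... | _ , _ , refl , _ , w′∈ = cong suc (∈-words⇒length k m w′∈)

∈-words⇒letters≤ : ∀ k m {w} → w ∈ words k m → All (_≤ m) w
∈-words⇒letters≤ zero    m (here refl) = []
∈-words⇒letters≤ (suc k) m p with ∈-words⁻ k m p
... | _ , _ , refl , a≤m , w′∈ = a≤m ∷ ∈-words⇒letters≤ k m w′∈

sum-words : ∀ k m (c : List ℕ → ℕ) → (∀ w → All (_≤ suc m) w → Any (2 ≤_) w → c w ≡ 0) →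
  sum (map c (words k (suc m))) ≡ c (replicate k 1)
sum-words zero    m c h = +-identityʳ (c [])
sum-words (suc k) m c h = begin
  sum (map c (words (suc k) (suc m)))
    ≡⟨ sum-map-concatMap c (λ a → map (a ∷_) ws) (map suc (upTo (suc m))) ⟩
  sum (map c (map (1 ∷_) ws)) + sum (map startingWith letters≥2)
    ≡⟨ cong₂ _+_ ones-term (sum-map-zero _ letters≥2 startingWith≥2) ⟩
  c (replicate (suc k) 1) + 0
    ≡⟨ +-identityʳ _ ⟩
  c (replicate (suc k) 1) ∎
  where
  open ≡-Reasoning
  ws : List (List ℕ)
  ws = words k (suc m)
  letters≥2 : List ℕ
  letters≥2 = map suc (applyUpTo suc m)
  startingWith : ℕ → ℕ
  startingWith a = sum (map c (map (a ∷_) ws))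

  ones-term : sum (map c (map (1 ∷_) ws)) ≡ c (replicate (suc k) 1)
  ones-term = trans (cong sum (sym (map-∘ ws)))
    (sum-words k m (c ∘ (1 ∷_)) (λ w ≤m ≥2 → h (1 ∷ w) (s≤s z≤n ∷ ≤m) (there ≥2)))

  startingWith≥2 : ∀ {a} → a ∈ letters≥2 → startingWith a ≡ 0
  startingWith≥2 a∈ with ∈-map⁻ suc a∈
  ... | b , b∈ , refl with ∈-applyUpTo⁻ suc b∈
  ... | i , i<m , refl = sum-map-zero c _ λ w∈ → vanish (∈-map⁻ _ w∈)
    where
    vanish : ∀ {w} → Σ (List ℕ) (λ w′ → w′ ∈ ws × w ≡ suc (suc i) ∷ w′) → c w ≡ 0
    vanish (w′ , w′∈ , refl) = h _ (s≤s i<m ∷ ∈-words⇒letters≤ k (suc m) w′∈) (here (s≤s (s≤s z≤n)))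

rowWeak-tail : ∀ a as → rowWeak (a ∷ as) ≡ true → rowWeak as ≡ true
rowWeak-tail a []       h = refl
rowWeak-tail a (b ∷ bs) h = ∧-conicalʳ (a ≤ᵇ b) _ h

rowWeak-head≤ : ∀ a as → rowWeak (a ∷ as) ≡ true → All (a ≤_) as
rowWeak-head≤ a []       h = []
rowWeak-head≤ a (b ∷ bs) h = a≤b ∷ All.map (≤-trans a≤b) (rowWeak-head≤ b bs (∧-conicalʳ (a ≤ᵇ b) _ h))
  where
  a≤b : a ≤ b
  a≤b = ≤ᵇ≡true⇒≤ (∧-conicalˡ _ _ h)

rowWeak-last≥2 : ∀ m w → rowWeak w ≡ true → All (_≤ m) w → Any (2 ≤_) w →
  Σ ℕ λ a → Σ (List ℕ) λ u → reverse w ≡ a ∷ u × 2 ≤ a × a ≤ m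
rowWeak-last≥2 m (b ∷ [])      rw (b≤m ∷ []) (here 2≤b) = b , [] , refl , 2≤b , b≤m
rowWeak-last≥2 m (b ∷ b′ ∷ w) rw (_ ∷ ≤m)   any≥2
  with rowWeak-last≥2 m (b′ ∷ w) (rowWeak-tail b (b′ ∷ w) rw) ≤m (tail≥2 any≥2)
  where
  tail≥2 : Any (2 ≤_) (b ∷ b′ ∷ w) → Any (2 ≤_) (b′ ∷ w)
  tail≥2 (here 2≤b) = here (≤-trans 2≤b (≤ᵇ≡true⇒≤ (∧-conicalˡ _ _ rw)))
  tail≥2 (there p)  = p
... | a , u , eq , 2≤a , a≤m = a , u ∷ʳ b , trans (unfold-reverse b (b′ ∷ w)) (cong (_∷ʳ b) eq) , 2≤a , a≤m

latticeAt : ℕ → List ℕ → Bool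
latticeAt m p = allB (λ i → count (suc (suc i)) p ≤ᵇ count (suc i) p) (upTo m)

[]∈prefixes : ∀ u → [] ∈ prefixes u
[]∈prefixes []      = here refl
[]∈prefixes (x ∷ u) = here refl

-- The one-letter prefix a contains an a but no a − 1.
lattice-∷-false : ∀ m a u → 2 ≤ a → a ≤ m → lattice m (a ∷ u) ≡ false
lattice-∷-false m (suc (suc i)) u (s≤s (s≤s z≤n)) a≤m =
  allB-false (latticeAt m) (prefixes (suc (suc i) ∷ u)) (there (∈-map⁺ (suc (suc i) ∷_) ([]∈prefixes u)))
    (allB-false _ (upTo m) (∈-upTo⁺ {m} {i} (≤-trans (n≤1+n (suc i)) a≤m)) more-a)
  where
  more-a : (count (suc (suc i)) [ suc (suc i) ] ≤ᵇ count (suc i) [ suc (suc i) ]) ≡ false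
  more-a rewrite ≡ᵇ-refl i | ≢⇒≡ᵇ≡false {i} {suc i} (λ e → 1+n≢n (sym e)) = refl

isLR-firstRow≥2 : ∀ lam mu nu w R → All (_≤ length mu) w → Any (2 ≤_) w → isLR lam mu nu (w ∷ R) ≡ false
isLR-firstRow≥2 lam mu nu w R ≤m any≥2 with rowWeak w in rw
... | false = refl
... | true with rowWeak-last≥2 (length mu) w rw ≤m any≥2
... | a , u , eq , 2≤a , a≤m
  rewrite eq | lattice-∷-false (length mu) a (u ++ reverseReading R) 2≤a a≤m
        | ∧-zeroʳ (contentIs mu (w ∷ R))
        | ∧-zeroʳ (colsStrict lam nu (w ∷ R)) = ∧-zeroʳ (rowsWeak R)

countBy-isLR-candidates : ∀ lam y ys x xs →
  countBy (isLR lam (y ∷ ys) (x ∷ xs)) (candidates lam (x ∷ xs) (suc (length ys)))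
  ≡ countBy (λ R → isLR lam (y ∷ ys) (x ∷ xs) (replicate (x ∸ part lam 0) 1 ∷ R))
            (candidatesFrom lam (x ∷ xs) (suc (length ys)) 1 (length xs))
countBy-isLR-candidates lam y ys x xs =
  trans (countBy-concatMap isLR′ (λ row → map (row ∷_) rest) (words (x ∸ part lam 0) (suc (length ys))))
  (trans (sum-words (x ∸ part lam 0) (length ys) withFirstRow vanish)
         (countBy-map isLR′ (replicate (x ∸ part lam 0) 1 ∷_) rest))
  where
  isLR′ : List (List ℕ) → Bool
  isLR′ = isLR lam (y ∷ ys) (x ∷ xs)
  rest : List (List (List ℕ))
  rest = candidatesFrom lam (x ∷ xs) (suc (length ys)) 1 (length xs)
  withFirstRow : List ℕ → ℕ
  withFirstRow w = countBy isLR′ (map (w ∷_) rest)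
  vanish : ∀ w → All (_≤ suc (length ys)) w → Any (2 ≤_) w → withFirstRow w ≡ 0
  vanish w ≤m any≥2 = trans (countBy-map isLR′ (w ∷_) rest)
    (countBy-none _ rest (λ R → isLR-firstRow≥2 lam (y ∷ ys) (x ∷ xs) w R ≤m any≥2))

count≤ : ℕ → List ℕ → ℕ
count≤ v []       = 0
count≤ v (a ∷ as) = if a ≤ᵇ v then suc (count≤ v as) else count≤ v as

count≤-length : ∀ v row → count≤ v row ≤ length row
count≤-length v []       = z≤n
count≤-length v (a ∷ as) with a ≤ᵇ v
... | true  = s≤s (count≤-length v as)
... | false = m≤n⇒m≤1+n (count≤-length v as)

count≤-none : ∀ v as → All (v <_) as → count≤ v as ≡ 0
count≤-none v []       _          = refl
count≤-none v (a ∷ as) (v<a ∷ ps) rewrite >⇒≤ᵇ≡false v<a = count≤-none v as ps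

nth-All : ∀ {P : ℕ → Set} xs t {b} → All P xs → nth xs t ≡ just b → P b
nth-All (x ∷ xs) zero    (p ∷ ps) refl = p
nth-All (x ∷ xs) (suc t) (p ∷ ps) e    = nth-All xs t ps e

-- In a weakly increasing row the entries ≤ v form a prefix.
count≤⇒nth≤ : ∀ v row c → rowWeak row ≡ true → count≤ v row ≡ suc c → Σ ℕ λ a → nth row c ≡ just a × a ≤ v
count≤⇒nth≤ v (a ∷ as) c rw e with a ≤ᵇ v in a≤ᵇv
count≤⇒nth≤ v (a ∷ as) zero    rw e | true  = a , refl , ≤ᵇ≡true⇒≤ a≤ᵇv
count≤⇒nth≤ v (a ∷ as) (suc c) rw e | true  = count≤⇒nth≤ v as c (rowWeak-tail a as rw) (suc-injective e)
... | false with () ← trans (sym e)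
  (count≤-none v as (All.map (<-≤-trans (≤ᵇ≡false⇒> a≤ᵇv)) (rowWeak-head≤ a as rw)))

nth≤⇒count≤ : ∀ v row t b → rowWeak row ≡ true → nth row t ≡ just b → b ≤ v → suc t ≤ count≤ v row
nth≤⇒count≤ v (a ∷ as) t b rw e b≤v with a ≤ᵇ v in a≤ᵇv
nth≤⇒count≤ v (a ∷ as) zero    b rw e    b≤v | true  = s≤s z≤n
nth≤⇒count≤ v (a ∷ as) (suc t) b rw e    b≤v | true  = s≤s (nth≤⇒count≤ v as t b (rowWeak-tail a as rw) e b≤v)
nth≤⇒count≤ v (a ∷ as) zero    b rw refl b≤v | false with () ← <⇒≱ (≤ᵇ≡false⇒> a≤ᵇv) b≤v
nth≤⇒count≤ v (a ∷ as) (suc t) b rw e    b≤v | false with () ←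
  <⇒≱ (≤ᵇ≡false⇒> a≤ᵇv) (≤-trans (nth-All as t (rowWeak-head≤ a as rw) e) b≤v)

count≤-suc : ∀ v row → count (suc v) row + count≤ v row ≤ count≤ (suc v) row
count≤-suc v []       = z≤n
count≤-suc v (a ∷ as) with a ≤? v
... | yes a≤v rewrite ≤⇒≤ᵇ≡true a≤v | ≤⇒≤ᵇ≡true (m≤n⇒m≤1+n a≤v)
                    | ≢⇒≡ᵇ≡false {suc v} {a} (λ e → <⇒≱ (s≤s ≤-refl) (subst (_≤ v) (sym e) a≤v))
  = subst (_≤ suc (count≤ (suc v) as)) (sym (+-suc (count (suc v) as) (count≤ v as)))
          (s≤s (count≤-suc v as))
... | no a≰v rewrite >⇒≤ᵇ≡false (≰⇒> a≰v) with suc v ≟ a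
...   | yes refl rewrite ≡ᵇ-refl v | ≤⇒≤ᵇ≡true (≤-refl {suc v}) = s≤s (count≤-suc v as)
...   | no v+1≢a rewrite ≢⇒≡ᵇ≡false v+1≢a
                       | >⇒≤ᵇ≡false (≤∧≢⇒< (≰⇒> a≰v) v+1≢a) = count≤-suc v as

part-suc≤part : ∀ p r → IsPartition p → part p (suc r) ≤ part p r
part-suc≤part []           r       _                = z≤n
part-suc≤part (x ∷ [])     zero    _                = z≤n
part-suc≤part (x ∷ [])     (suc r) _                = z≤n
part-suc≤part (x ∷ y ∷ xs) zero    (y≤x ∷ _ , _)    = y≤x
part-suc≤part (x ∷ y ∷ xs) (suc r) (_ ∷ l , _ ∷ ps) = part-suc≤part (y ∷ xs) r (l , ps)

0<part⇒<length : ∀ p i → 0 < part p i → i < length p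
0<part⇒<length (x ∷ p) zero    h = s≤s z≤n
0<part⇒<length (x ∷ p) (suc i) h = s≤s (0<part⇒<length p i h)

nth⇒<length : ∀ {A : Set} (xs : List A) t {b} → nth xs t ≡ just b → t < length xs
nth⇒<length (x ∷ xs) zero    e = s≤s z≤n
nth⇒<length (x ∷ xs) (suc t) e = s≤s (nth⇒<length xs t e)

nth⇒∈ : ∀ {A : Set} (xs : List A) t {b} → nth xs t ≡ just b → b ∈ xs
nth⇒∈ (x ∷ xs) zero    refl = here refl
nth⇒∈ (x ∷ xs) (suc t) e    = there (nth⇒∈ xs t e)

drop⇒nth : ∀ {A : Set} (T : List A) n {a L} → drop n T ≡ a ∷ L → nth T n ≡ just a
drop⇒nth (x ∷ T) zero    refl = refl
drop⇒nth (x ∷ T) (suc n) e    = drop⇒nth T n e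

drop-suc : ∀ {A : Set} (T : List A) n {a L} → drop n T ≡ a ∷ L → drop (suc n) T ≡ L
drop-suc (x ∷ T) zero    refl = refl
drop-suc (x ∷ T) (suc n) e    = drop-suc T n e

<∸⇒+< : ∀ m n c → c < n ∸ m → m + c < n
<∸⇒+< zero    n       c p = p
<∸⇒+< (suc m) (suc n) c p = s≤s (<∸⇒+< m n c p)

∈-range⁺ : ∀ lo hi j → lo ≤ j → j < hi → j ∈ range lo hi
∈-range⁺ lo hi j lo≤j j<hi = subst (_∈ range lo hi) (m+[n∸m]≡n lo≤j) (∈-map⁺ (lo +_) (∈-upTo⁺ (∸-monoˡ-< j<hi lo≤j)))

∈-range⁻ : ∀ lo hi {j} → j ∈ range lo hi → j < hi
∈-range⁻ lo hi p with ∈-map⁻ (lo +_) p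
... | i , i∈ , refl = <∸⇒+< lo hi i (∈-upTo⁻ i∈)

entry-skew : ∀ lam T r j {row} → nth T r ≡ just row → part lam r ≤ j → entry lam T r j ≡ nth row (j ∸ part lam r)
entry-skew lam T r j e λ≤j with nth T r
entry-skew lam T r j refl λ≤j | just _ rewrite ≤⇒≤ᵇ≡true λ≤j = refl

record IsSSYT (lam nu : List ℕ) (T : List (List ℕ)) : Set where
  field
    cols      : colsStrict lam nu T ≡ true
    rowWeakAt : ∀ r {row} → nth T r ≡ just row → rowWeak row ≡ true
    lengthAt  : ∀ r {row} → nth T r ≡ just row → length row ≡ part nu r ∸ part lam r
open IsSSYT

ltM-just⁻ : ∀ x a → ltM x (just a) ≡ true → Σ ℕ λ b → x ≡ just b × b < a
ltM-just⁻ (just b) a e = b , refl , <ᵇ≡true⇒< e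

if-∧-true : ∀ {A B X} → (if A ∧ B then X else true) ≡ true → A ≡ true → B ≡ true → X ≡ true
if-∧-true h refl refl = h

colsStrict-at : ∀ lam nu T r j → colsStrict lam nu T ≡ true →
  part lam (suc r) ≤ j → j < part nu (suc r) → part lam r ≤ j → j < part nu r →
  ltM (entry lam T r j) (entry lam T (suc r) j) ≡ true
colsStrict-at lam nu T r j cs λ′≤j j<ν′ λ≤j j<ν = if-∧-true
  (allB-∈ _ (range (part lam (suc r)) (part nu (suc r)))
     (allB-∈ _ (upTo (length nu)) cs (∈-upTo⁺ (<⇒≤ (0<part⇒<length nu (suc r) (≤-<-trans z≤n j<ν′)))))
     (∈-range⁺ _ _ j λ′≤j j<ν′))
  (≤⇒≤ᵇ≡true λ≤j) (<⇒<ᵇ≡true j<ν)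

cell-above : ∀ lam nu T r j {row row′ a} → IsPartition nu → IsSSYT lam nu T →
  nth T r ≡ just row → nth T (suc r) ≡ just row′ →
  part lam (suc r) ≤ j → nth row′ (j ∸ part lam (suc r)) ≡ just a →
  j < part lam r ⊎ Σ ℕ λ b → part lam r ≤ j × nth row (j ∸ part lam r) ≡ just b × b < a
cell-above lam nu T r j {row} {row′} {a} pnu ssyt er er′ λ′≤j ea with part lam r ≤? j
... | no λ≰j = inj₁ (≰⇒> λ≰j)
... | yes λ≤j with ltM-just⁻ (entry lam T r j) a (subst (λ e → ltM (entry lam T r j) e ≡ true) below strict)
  where
  below : entry lam T (suc r) j ≡ just a
  below = trans (entry-skew lam T (suc r) j er′ λ′≤j) ea
  j<ν′ : j < part nu (suc r)
  j<ν′ = subst (_< part nu (suc r)) (m+[n∸m]≡n λ′≤j)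
           (<∸⇒+< (part lam (suc r)) (part nu (suc r)) _ (subst (_ <_) (lengthAt ssyt (suc r) er′) (nth⇒<length row′ _ ea)))
  strict : ltM (entry lam T r j) (entry lam T (suc r) j) ≡ true
  strict = colsStrict-at lam nu T r j (cols ssyt) λ′≤j j<ν′ λ≤j (<-≤-trans j<ν′ (part-suc≤part nu r pnu))
... | b , eb , b<a = inj₂ (b , λ≤j , above , b<a)
  where
  above : nth row (j ∸ part lam r) ≡ just b
  above = trans (sym (entry-skew lam T r j er λ≤j)) eb

count-++ : ∀ i xs ys → count i (xs ++ ys) ≡ count i xs + count i ys
count-++ i []       ys = refl
count-++ i (x ∷ xs) ys with i ≡ᵇ x
... | true  = cong suc (count-++ i xs ys)
... | false = count-++ i xs ys

-- The entries ≤ v+1 of row r+1 sit below cells of λ or entries ≤ v of row r.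
count≤-below : ∀ lam nu T r v {row row′} → IsPartition lam → IsPartition nu → IsSSYT lam nu T →
  nth T r ≡ just row → nth T (suc r) ≡ just row′ →
  part lam (suc r) + count≤ (suc v) row′ ≤ part lam r + count≤ v row
count≤-below lam nu T r v {row} {row′} plam pnu ssyt er er′ with count≤ (suc v) row′ in count≡
... | zero = begin
  part lam (suc r) + 0     ≡⟨ +-identityʳ _ ⟩
  part lam (suc r)         ≤⟨ part-suc≤part lam r plam ⟩
  part lam r               ≤⟨ m≤m+n _ _ ⟩
  part lam r + count≤ v row ∎
  where open ≤-Reasoning
... | suc c with count≤⇒nth≤ (suc v) row′ c (rowWeakAt ssyt (suc r) er′) count≡
... | a , ea , a≤1+v
  with cell-above lam nu T r (part lam (suc r) + c) pnu ssyt er er′ (m≤m+n _ c)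
         (subst (λ t → nth row′ t ≡ just a) (sym (m+n∸m≡n (part lam (suc r)) c)) ea)
... | inj₁ j<λ = begin
  part lam (suc r) + suc c   ≡⟨ +-suc _ c ⟩
  suc (part lam (suc r) + c) ≤⟨ j<λ ⟩
  part lam r                 ≤⟨ m≤m+n _ _ ⟩
  part lam r + count≤ v row  ∎
  where open ≤-Reasoning
... | inj₂ (b , λ≤j , eb , b<a) = begin
  part lam (suc r) + suc c   ≡⟨ +-suc _ c ⟩
  suc j                      ≡⟨ cong suc (m+[n∸m]≡n λ≤j) ⟨
  suc (λr + (j ∸ λr))        ≡⟨ +-suc λr _ ⟨
  λr + suc (j ∸ λr)          ≤⟨ +-monoʳ-≤ λr (nth≤⇒count≤ v row (j ∸ λr) b (rowWeakAt ssyt r er) eb (≤-pred (≤-trans b<a a≤1+v))) ⟩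
  λr + count≤ v row          ∎
  where
  open ≤-Reasoning
  j λr : ℕ
  j = part lam (suc r) + c
  λr = part lam r

count-∷≤ : ∀ v row R bound → count (suc v) (concat R) ≤ bound + count≤ v row →
  count (suc v) (concat (row ∷ R)) ≤ bound + count≤ (suc v) row
count-∷≤ v row R bound h = begin
  count (suc v) (row ++ concat R)                 ≡⟨ count-++ (suc v) row (concat R) ⟩
  count (suc v) row + count (suc v) (concat R)    ≤⟨ +-monoʳ-≤ (count (suc v) row) h ⟩
  count (suc v) row + (bound + count≤ v row)      ≡⟨ x∙yz≈y∙xz (count (suc v) row) bound _ ⟩
  bound + (count (suc v) row + count≤ v row)      ≤⟨ +-monoʳ-≤ bound (count≤-suc v row) ⟩
  bound + count≤ (suc v) row                      ∎
  where open ≤-Reasoning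

count-below : ∀ lam nu T v r {row} R → IsPartition lam → IsPartition nu → IsSSYT lam nu T →
  nth T r ≡ just row → drop (suc r) T ≡ R → count (suc v) (concat R) ≤ part lam r + count≤ v row
count-below lam nu T v r []           plam pnu ssyt er ed = z≤n
count-below lam nu T v r (row′ ∷ R′) plam pnu ssyt er ed =
  ≤-trans (count-∷≤ v row′ R′ (part lam (suc r)) (count-below lam nu T v (suc r) R′ plam pnu ssyt er′ (drop-suc T (suc r) ed)))
          (count≤-below lam nu T r v plam pnu ssyt er er′)
  where
  er′ : nth T (suc r) ≡ just row′
  er′ = drop⇒nth T (suc r) ed

∈-candidatesFrom⁻ : ∀ lam nu m r n {R} → R ∈ candidatesFrom lam nu m r n →
  (∀ i {row} → nth R i ≡ just row → length row ≡ part nu (r + i) ∸ part lam (r + i)) × All (All (_≤ m)) R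
∈-candidatesFrom⁻ lam nu m r zero    (here refl) = (λ _ ()) , []
∈-candidatesFrom⁻ lam nu m r (suc n) p
  with ∈-concatMap-∷⁻ (words (part nu r ∸ part lam r) m) (candidatesFrom lam nu m (suc r) n) p
... | row , R′ , refl , row∈ , R′∈ with ∈-candidatesFrom⁻ lam nu m (suc r) n R′∈
... | lengths , letters = rowLengths , ∈-words⇒letters≤ (part nu r ∸ part lam r) m row∈ ∷ letters
  where
  rowLengths : ∀ i {row₁} → nth (row ∷ R′) i ≡ just row₁ → length row₁ ≡ part nu (r + i) ∸ part lam (r + i)
  rowLengths zero    refl rewrite +-identityʳ r = ∈-words⇒length (part nu r ∸ part lam r) m row∈
  rowLengths (suc i) e    rewrite +-suc r i     = lengths i e

candidatesFrom-head : ∀ lam x x′ xs m n r →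
  candidatesFrom lam (x ∷ xs) m (suc r) n ≡ candidatesFrom lam (x′ ∷ xs) m (suc r) n
candidatesFrom-head lam x x′ xs m zero    r = refl
candidatesFrom-head lam x x′ xs m (suc n) r =
  cong (λ L → concatMap (λ row → map (row ∷_) L) (words (part xs r ∸ part lam (suc r)) m))
       (candidatesFrom-head lam x x′ xs m n (suc r))

TailShape : List ℕ → List ℕ → List (List ℕ) → Set
TailShape lam nu R = ∀ i {row} → nth R i ≡ just row → length row ≡ part nu (suc i) ∸ part lam (suc i)

isSSYT : ∀ lam nu row R → colsStrict lam nu (row ∷ R) ≡ true → rowsWeak (row ∷ R) ≡ true →
  length row ≡ part nu 0 ∸ part lam 0 → TailShape lam nu R → IsSSYT lam nu (row ∷ R)
isSSYT lam nu row R cs rw length₀ shape = record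
  { cols      = cs
  ; rowWeakAt = λ r e → allB-∈ rowWeak (row ∷ R) rw (nth⇒∈ (row ∷ R) r e)
  ; lengthAt  = λ { zero refl → length₀ ; (suc i) e → shape i e }
  }

rowWeak-replicate : ∀ k a → rowWeak (replicate k a) ≡ true
rowWeak-replicate zero          a = refl
rowWeak-replicate (suc zero)    a = refl
rowWeak-replicate (suc (suc k)) a = cong₂ _∧_ (≤⇒≤ᵇ≡true (≤-refl {a})) (rowWeak-replicate (suc k) a)

replicate-∷ʳ : ∀ {A : Set} k (a : A) → replicate k a ∷ʳ a ≡ a ∷ replicate k a
replicate-∷ʳ zero    a = refl
replicate-∷ʳ (suc k) a = cong (a ∷_) (replicate-∷ʳ k a)

reverse-replicate : ∀ {A : Set} k (a : A) → reverse (replicate k a) ≡ replicate k a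
reverse-replicate zero    a = refl
reverse-replicate (suc k) a = begin
  reverse (a ∷ replicate k a)    ≡⟨ unfold-reverse a (replicate k a) ⟩
  reverse (replicate k a) ∷ʳ a   ≡⟨ cong (_∷ʳ a) (reverse-replicate k a) ⟩
  replicate k a ∷ʳ a             ≡⟨ replicate-∷ʳ k a ⟩
  a ∷ replicate k a              ∎
  where open ≡-Reasoning

nth-replicate : ∀ {A : Set} k (a : A) t → t < k → nth (replicate k a) t ≡ just a
nth-replicate (suc k) a zero    _         = refl
nth-replicate (suc k) a (suc t) (s≤s t<k) = nth-replicate k a t t<k

count-replicate : ∀ k a → count a (replicate k a) ≡ k
count-replicate zero    a = refl
count-replicate (suc k) a rewrite ≡ᵇ-refl a = cong suc (count-replicate k a)

count-replicate-≢ : ∀ k {i a} → ¬ i ≡ a → count i (replicate k a) ≡ 0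
count-replicate-≢ zero    i≢a = refl
count-replicate-≢ (suc k) i≢a rewrite ≢⇒≡ᵇ≡false i≢a = count-replicate-≢ k i≢a

colsStrict-firstRow-suc : ∀ lam x xs k R → IsPartition (x ∷ xs) → part lam 0 + k ≡ x →
  colsStrict lam (x ∷ xs) (replicate k 1 ∷ R) ≡ colsStrict lam (suc x ∷ xs) (replicate (suc k) 1 ∷ R)
colsStrict-firstRow-suc lam x xs k R pnu λ+k≡x = allB-cong _ _ (upTo (suc (length xs))) λ
  { {zero} _ → allB-cong _ _ (range (part lam 1) (part xs 0)) λ {j} j∈ →
      cell j (<-≤-trans (∈-range⁻ _ _ j∈) (part-suc≤part (x ∷ xs) 0 pnu))
  ; {suc r} _ → refl }
  where
  j∸λ<k : ∀ {j} → j < x → part lam 0 ≤ j → j ∸ part lam 0 < k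
  j∸λ<k j<x λ≤j = subst (_ <_) (trans (cong (_∸ part lam 0) (sym λ+k≡x)) (m+n∸m≡n (part lam 0) k))
                        (∸-monoˡ-< j<x λ≤j)
  cell : ∀ j → j < x →
    (if (part lam 0 ≤ᵇ j) ∧ (j <ᵇ x) then ltM (entry lam (replicate k 1 ∷ R) 0 j) (entry lam (replicate k 1 ∷ R) 1 j) else true)
    ≡ (if (part lam 0 ≤ᵇ j) ∧ (j <ᵇ suc x) then ltM (entry lam (replicate (suc k) 1 ∷ R) 0 j) (entry lam (replicate (suc k) 1 ∷ R) 1 j) else true)
  cell j j<x with part lam 0 ≤? j
  ... | no λ≰j rewrite >⇒≤ᵇ≡false (≰⇒> λ≰j) = refl
  ... | yes λ≤j rewrite ≤⇒≤ᵇ≡true λ≤j | <⇒<ᵇ≡true j<x | <⇒<ᵇ≡true (m≤n⇒m≤1+n j<x)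
                      | nth-replicate k 1 (j ∸ part lam 0) (j∸λ<k j<x λ≤j)
                      | nth-replicate (suc k) 1 (j ∸ part lam 0) (m≤n⇒m≤1+n (j∸λ<k j<x λ≤j)) = refl

contentIs-firstRow-suc : ∀ y ys k R →
  contentIs (y ∷ ys) (replicate k 1 ∷ R) ≡ contentIs (suc y ∷ ys) (replicate (suc k) 1 ∷ R)
contentIs-firstRow-suc y ys k R = allB-cong _ _ (upTo (suc (length ys))) λ { {zero} _ → refl ; {suc i} _ → refl }

latticeAt-1∷ : ∀ m p → count 2 p ≤ count 1 p → latticeAt (suc m) (1 ∷ p) ≡ latticeAt (suc m) p
latticeAt-1∷ m p h = allB-cong _ _ (upTo (suc m)) λ
  { {zero} _ → trans (≤⇒≤ᵇ≡true (m≤n⇒m≤1+n h)) (sym (≤⇒≤ᵇ≡true h)) ; {suc i} _ → refl }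

count-prefix≤ : ∀ i V {p} → p ∈ prefixes V → count i p ≤ count i V
count-prefix≤ i []      (here refl) = z≤n
count-prefix≤ i (x ∷ V) (here refl) = z≤n
count-prefix≤ i (x ∷ V) (there q) with ∈-map⁻ (x ∷_) q
... | p′ , p′∈ , refl with i ≡ᵇ x
... | true  = s≤s (count-prefix≤ i V p′∈)
... | false = count-prefix≤ i V p′∈

count₂-prefix≤ : ∀ k c V {p} → p ∈ prefixes (replicate k 1 ++ V) → count 2 V ≤ k + c → count 2 p ≤ count 1 p + c
count₂-prefix≤ zero    c V q           h = ≤-trans (count-prefix≤ 2 V q) (≤-trans h (m≤n+m c _))
count₂-prefix≤ (suc k) c V (here refl) h = z≤n
count₂-prefix≤ (suc k) c V (there q)   h with ∈-map⁻ (1 ∷_) q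
... | p′ , p′∈ , refl = subst (count 2 p′ ≤_) (+-suc (count 1 p′) c)
                          (count₂-prefix≤ k (suc c) V p′∈ (subst (count 2 V ≤_) (sym (+-suc k c)) h))

-- Every prefix of 11…1V has at least as many 1s as 2s, so one more leading 1 changes nothing.
lattice-1∷ : ∀ m k V → count 2 V ≤ k → lattice (suc m) (replicate k 1 ++ V) ≡ lattice (suc m) (1 ∷ replicate k 1 ++ V)
lattice-1∷ m k V twos≤k = begin
  allB ok (prefixes w)                     ≡⟨ allB-cong _ _ (prefixes w) (λ {p} p∈ → sym (latticeAt-1∷ m p (balanced p∈))) ⟩
  allB (ok ∘ (1 ∷_)) (prefixes w)          ≡⟨ allB-map ok (1 ∷_) (prefixes w) ⟨
  allB ok (map (1 ∷_) (prefixes w))        ≡⟨ cong (_∧ allB ok (map (1 ∷_) (prefixes w))) (allB-true _ (upTo (suc m)) (λ _ → refl)) ⟨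
  ok [] ∧ allB ok (map (1 ∷_) (prefixes w)) ∎
  where
  open ≡-Reasoning
  ok : List ℕ → Bool
  ok = latticeAt (suc m)
  w : List ℕ
  w = replicate k 1 ++ V
  balanced : ∀ {p} → p ∈ prefixes w → count 2 p ≤ count 1 p
  balanced {p} p∈ = subst (count 2 p ≤_) (+-identityʳ _)
                      (count₂-prefix≤ k 0 V p∈ (subst (count 2 V ≤_) (sym (+-identityʳ k)) twos≤k))

count-reverse : ∀ i xs → count i (reverse xs) ≡ count i xs
count-reverse i []       = refl
count-reverse i (x ∷ xs) = begin
  count i (reverse (x ∷ xs))            ≡⟨ cong (count i) (unfold-reverse x xs) ⟩
  count i (reverse xs ∷ʳ x)             ≡⟨ count-++ i (reverse xs) [ x ] ⟩
  count i (reverse xs) + count i [ x ]  ≡⟨ +-comm (count i (reverse xs)) _ ⟩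
  count i [ x ] + count i (reverse xs)  ≡⟨ cong (count i [ x ] +_) (count-reverse i xs) ⟩
  count i [ x ] + count i xs            ≡⟨ count-++ i [ x ] xs ⟨
  count i (x ∷ xs)                      ∎
  where open ≡-Reasoning

count-reverseReading : ∀ i R → count i (reverseReading R) ≡ count i (concat R)
count-reverseReading i []        = refl
count-reverseReading i (row ∷ R) = begin
  count i (reverse row ++ reverseReading R)        ≡⟨ count-++ i (reverse row) _ ⟩
  count i (reverse row) + count i (reverseReading R) ≡⟨ cong₂ _+_ (count-reverse i row) (count-reverseReading i R) ⟩
  count i row + count i (concat R)                 ≡⟨ count-++ i row (concat R) ⟨
  count i (row ++ concat R)                        ∎
  where open ≡-Reasoning

∧₄-cong : ∀ {a a′ b b′ c c′ d d′} → a ≡ a′ → b ≡ b′ → c ≡ c′ → (a ≡ true → b ≡ true → c ≡ true → d ≡ d′) →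
  a ∧ b ∧ c ∧ d ≡ a′ ∧ b′ ∧ c′ ∧ d′
∧₄-cong {false}                       refl refl refl h = refl
∧₄-cong {true} {b = false}            refl refl refl h = refl
∧₄-cong {true} {b = true} {c = false} refl refl refl h = refl
∧₄-cong {true} {b = true} {c = true}  refl refl refl h = h refl refl refl

isLR-firstRow-suc : ∀ lam y ys x xs k R → IsPartition (x ∷ xs) → part lam 0 + k ≡ x →
  (rowsWeak (replicate k 1 ∷ R) ≡ true → colsStrict lam (x ∷ xs) (replicate k 1 ∷ R) ≡ true →
   contentIs (y ∷ ys) (replicate k 1 ∷ R) ≡ true → count 2 (concat R) ≤ k) →
  isLR lam (y ∷ ys) (x ∷ xs) (replicate k 1 ∷ R) ≡ isLR lam (suc y ∷ ys) (suc x ∷ xs) (replicate (suc k) 1 ∷ R)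
isLR-firstRow-suc lam y ys x xs k R pnu λ+k≡x twos≤k =
  ∧₄-cong (cong (_∧ rowsWeak R) (trans (rowWeak-replicate k 1) (sym (rowWeak-replicate (suc k) 1))))
          (colsStrict-firstRow-suc lam x xs k R pnu λ+k≡x)
          (contentIs-firstRow-suc y ys k R)
          λ rw cs ct → begin
    lattice m (reverse (replicate k 1) ++ V)        ≡⟨ cong (λ w → lattice m (w ++ V)) (reverse-replicate k 1) ⟩
    lattice m (replicate k 1 ++ V)                  ≡⟨ lattice-1∷ (length ys) k V (subst (_≤ k) (sym (count-reverseReading 2 R)) (twos≤k rw cs ct)) ⟩
    lattice m (replicate (suc k) 1 ++ V)            ≡⟨ cong (λ w → lattice m (w ++ V)) (reverse-replicate (suc k) 1) ⟨
    lattice m (reverse (replicate (suc k) 1) ++ V)  ∎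
  where
  open ≡-Reasoning
  m : ℕ
  m = suc (length ys)
  V : List ℕ
  V = reverseReading R

size-part₀+part₁ : ∀ lam → part lam 0 + part lam 1 ≤ size lam
size-part₀+part₁ []          = z≤n
size-part₀+part₁ (a ∷ [])    = ≤-refl
size-part₀+part₁ (a ∷ b ∷ l) = +-monoʳ-≤ a (m≤m+n b _)

part₀≤size : ∀ lam → part lam 0 ≤ size lam
part₀≤size lam = ≤-trans (m≤m+n _ _) (size-part₀+part₁ lam)

m+[n∸m]≤o : ∀ m n o → m ≤ o → n ≤ o → m + (n ∸ m) ≤ o
m+[n∸m]≤o m n o m≤o n≤o with m ≤? n
... | yes m≤n = subst (_≤ o) (sym (m+[n∸m]≡n m≤n)) n≤o
... | no  m≰n = subst (_≤ o) (sym (trans (cong (m +_) (m≤n⇒m∸n≡0 (<⇒≤ (≰⇒> m≰n)))) (+-identityʳ m))) m≤o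

TwosBound : List ℕ → List ℕ → List ℕ → Set
TwosBound lam mu nu = ∀ k R → part lam 0 + k ≡ part nu 0 → All (All (_≤ length mu)) R →
  IsSSYT lam nu (replicate k 1 ∷ R) → contentIs mu (replicate k 1 ∷ R) ≡ true → count 2 (concat R) ≤ k

twosBound-νgap : ∀ lam mu x xs → IsPartition lam → IsPartition (x ∷ xs) → size lam ≤ x ∸ part xs 0 →
  TwosBound lam mu (x ∷ xs)
twosBound-νgap lam mu x xs plam pnu gap k []         λ+k≡x _ _    _ = z≤n
twosBound-νgap lam mu x xs plam pnu gap k (row ∷ R) λ+k≡x _ ssyt _ = begin
  count 2 (concat (row ∷ R))               ≤⟨ count-∷≤ 1 row R (part lam 1)
                                                (count-below lam (x ∷ xs) (replicate k 1 ∷ row ∷ R) 1 1 R plam pnu ssyt refl refl) ⟩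
  part lam 1 + count≤ 2 row                ≤⟨ +-monoʳ-≤ (part lam 1) (count≤-length 2 row) ⟩
  part lam 1 + length row                  ≡⟨ cong (part lam 1 +_) (lengthAt ssyt 1 refl) ⟩
  part lam 1 + (part xs 0 ∸ part lam 1)    ≤⟨ m+[n∸m]≤o (part lam 1) (part xs 0) k λ₁≤k ν₁≤k ⟩
  k                                        ∎
  where
  open ≤-Reasoning
  ν₁≤x : part xs 0 ≤ x
  ν₁≤x = part-suc≤part (x ∷ xs) 0 pnu
  λ₁≤k : part lam 1 ≤ k
  λ₁≤k = +-cancelˡ-≤ (part lam 0) _ _ (begin
    part lam 0 + part lam 1  ≤⟨ size-part₀+part₁ lam ⟩
    size lam                 ≤⟨ gap ⟩
    x ∸ part xs 0            ≤⟨ m∸n≤m x (part xs 0) ⟩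
    x                        ≡⟨ λ+k≡x ⟨
    part lam 0 + k           ∎)
  ν₁≤k : part xs 0 ≤ k
  ν₁≤k = +-cancelˡ-≤ (part lam 0) _ _ (begin
    part lam 0 + part xs 0             ≤⟨ +-monoˡ-≤ (part xs 0) (≤-trans (part₀≤size lam) gap) ⟩
    (x ∸ part xs 0) + part xs 0        ≡⟨ m∸n+n≡m ν₁≤x ⟩
    x                                  ≡⟨ λ+k≡x ⟨
    part lam 0 + k                     ∎)

contentIs-at : ∀ mu T i → contentIs mu T ≡ true → i < length mu → count (suc i) (concat T) ≡ part mu i
contentIs-at mu T i ct i<ℓ = ≡ᵇ≡true⇒≡ (allB-∈ _ (upTo (length mu)) ct (∈-upTo⁺ i<ℓ))

count₂-≤1 : ∀ R → All (All (_≤ 1)) R → count 2 (concat R) ≡ 0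
count₂-≤1 []        []       = refl
count₂-≤1 (row ∷ R) (p ∷ ps) = trans (count-++ 2 row (concat R)) (cong₂ _+_ (count₂-row row p) (count₂-≤1 R ps))
  where
  count₂-row : ∀ row → All (_≤ 1) row → count 2 row ≡ 0
  count₂-row []        []       = refl
  count₂-row (a ∷ row) (a≤1 ∷ qs) rewrite ≢⇒≡ᵇ≡false {2} {a} (λ { refl → <⇒≱ ≤-refl a≤1 }) = count₂-row row qs

twos≤part₁ : ∀ y ys k R → All (All (_≤ suc (length ys))) R → contentIs (y ∷ ys) (replicate k 1 ∷ R) ≡ true →
  count 2 (concat R) ≤ part ys 0
twos≤part₁ y []       k R letters ct = ≤-reflexive (count₂-≤1 R letters)
twos≤part₁ y (b ∷ bs) k R letters ct = ≤-reflexive (begin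
  count 2 (concat R)                                  ≡⟨ cong (_+ count 2 (concat R)) (count-replicate-≢ k {2} {1} λ ()) ⟨
  count 2 (replicate k 1) + count 2 (concat R)        ≡⟨ count-++ 2 (replicate k 1) (concat R) ⟨
  count 2 (concat (replicate k 1 ∷ R))                ≡⟨ contentIs-at (y ∷ b ∷ bs) (replicate k 1 ∷ R) 1 ct (s≤s (s≤s z≤n)) ⟩
  b                                                   ∎)
  where open ≡-Reasoning

twosBound-μgap : ∀ lam y ys x xs → IsPartition lam → IsPartition (y ∷ ys) → IsPartition (x ∷ xs) →
  size lam ≤ y ∸ part ys 0 → TwosBound lam (y ∷ ys) (x ∷ xs)
twosBound-μgap lam y ys x xs plam pmu pnu gap k R λ+k≡x letters ssyt ct = +-cancelʳ-≤ ones twos k (begin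
  twos + ones                  ≤⟨ +-mono-≤ (twos≤part₁ y ys k R letters ct) (≤-trans ones≤λ₀ (part₀≤size lam)) ⟩
  part ys 0 + size lam         ≤⟨ +-monoʳ-≤ (part ys 0) gap ⟩
  part ys 0 + (y ∸ part ys 0)  ≡⟨ m+[n∸m]≡n (part-suc≤part (y ∷ ys) 0 pmu) ⟩
  y                            ≡⟨ k+ones≡y ⟨
  k + ones                     ∎)
  where
  open ≤-Reasoning
  ones twos : ℕ
  ones = count 1 (concat R)
  twos = count 2 (concat R)
  ones≤λ₀ : ones ≤ part lam 0
  ones≤λ₀ = subst (ones ≤_) (trans (cong (part lam 0 +_) no0s) (+-identityʳ _))
              (count-below lam (x ∷ xs) (replicate k 1 ∷ R) 0 0 R plam pnu ssyt refl refl)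
    where
    no0s : count≤ 0 (replicate k 1) ≡ 0
    no0s = count≤-none 0 (replicate k 1) (replicate⁺ k (s≤s z≤n))
  k+ones≡y : k + ones ≡ y
  k+ones≡y = trans (cong (_+ ones) (sym (count-replicate k 1)))
               (trans (sym (count-++ 1 (replicate k 1) (concat R))) (contentIs-at (y ∷ ys) (replicate k 1 ∷ R) 0 ct (s≤s z≤n)))

containedB-suc : ∀ lam x xs → part lam 0 ≤ x → containedB lam (x ∷ xs) ≡ containedB lam (suc x ∷ xs)
containedB-suc lam x xs λ≤x = cong ((length lam ≤ᵇ suc (length xs)) ∧_) (allB-cong _ _ (upTo (suc (length xs))) λ
  { {zero} _ → trans (≤⇒≤ᵇ≡true λ≤x) (sym (≤⇒≤ᵇ≡true (m≤n⇒m≤1+n λ≤x))) ; {suc r} _ → refl })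

containedB-false : ∀ lam x xs → x < part lam 0 → containedB lam (x ∷ xs) ≡ false
containedB-false lam x xs x<λ =
  trans (cong ((length lam ≤ᵇ suc (length xs)) ∧_) (allB-false _ (upTo (suc (length xs))) (here refl) (>⇒≤ᵇ≡false x<λ)))
        (∧-zeroʳ _)

LR-plus : ∀ lam y ys x xs → IsPartition (x ∷ xs) → part lam 0 ≤ x → TwosBound lam (y ∷ ys) (x ∷ xs) →
  LR lam (y ∷ ys) (x ∷ xs) ≡ LR lam (suc y ∷ ys) (suc x ∷ xs)
LR-plus lam y ys x xs pnu λ≤x twos =
  trans (if-cong (containedB-suc lam x xs λ≤x)) (if-cong-then (containedB lam (suc x ∷ xs)) tableaux)
  where
  open ≡-Reasoning
  m k : ℕ
  m = suc (length ys)
  k = x ∸ part lam 0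
  rest : List (List (List ℕ))
  rest = candidatesFrom lam (x ∷ xs) m 1 (length xs)
  withFirstRow : ℕ → List (List ℕ) → Bool
  withFirstRow n R = isLR lam (suc y ∷ ys) (suc x ∷ xs) (replicate n 1 ∷ R)

  addOne : ∀ {R} → R ∈ rest →
    isLR lam (y ∷ ys) (x ∷ xs) (replicate k 1 ∷ R) ≡ isLR lam (suc y ∷ ys) (suc x ∷ xs) (replicate (suc k) 1 ∷ R)
  addOne R∈ with ∈-candidatesFrom⁻ lam (x ∷ xs) m 1 (length xs) R∈
  ... | shape , letters = isLR-firstRow-suc lam y ys x xs k _ pnu (m+[n∸m]≡n λ≤x) λ rw cs ct →
    twos k _ (m+[n∸m]≡n λ≤x) letters (isSSYT lam (x ∷ xs) (replicate k 1) _ cs rw (length-replicate k) shape) ct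

  tableaux : countBy (isLR lam (y ∷ ys) (x ∷ xs)) (candidates lam (x ∷ xs) m)
           ≡ countBy (isLR lam (suc y ∷ ys) (suc x ∷ xs)) (candidates lam (suc x ∷ xs) m)
  tableaux = begin
    countBy (isLR lam (y ∷ ys) (x ∷ xs)) (candidates lam (x ∷ xs) m)
      ≡⟨ countBy-isLR-candidates lam y ys x xs ⟩
    countBy (λ R → isLR lam (y ∷ ys) (x ∷ xs) (replicate k 1 ∷ R)) rest
      ≡⟨ countBy-cong _ _ rest addOne ⟩
    countBy (withFirstRow (suc k)) rest
      ≡⟨ cong₂ (λ k′ L → countBy (withFirstRow k′) L) (+-∸-assoc 1 λ≤x) (candidatesFrom-head lam (suc x) x xs m (length xs) 0) ⟨
    countBy (withFirstRow (suc x ∸ part lam 0)) (candidatesFrom lam (suc x ∷ xs) m 1 (length xs))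
      ≡⟨ countBy-isLR-candidates lam (suc y) ys (suc x) xs ⟨
    countBy (isLR lam (suc y ∷ ys) (suc x ∷ xs)) (candidates lam (suc x ∷ xs) m) ∎

IsPartition-tail : ∀ x xs → IsPartition (x ∷ xs) → IsPartition xs
IsPartition-tail x []       _                   = [] , []
IsPartition-tail x (y ∷ xs) (_ ∷ l , _ ∷ pos) = l , pos

IsPartition-suc : ∀ x xs → IsPartition (x ∷ xs) → IsPartition (suc x ∷ xs)
IsPartition-suc x []       (_ , _ ∷ pos)         = [-] , s≤s z≤n ∷ pos
IsPartition-suc x (y ∷ xs) (y≤x ∷ l , _ ∷ pos) = m≤n⇒m≤1+n y≤x ∷ l , s≤s z≤n ∷ pos

size≤0⇒[] : ∀ p → IsPartition p → size p ≤ 0 → p ≡ []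
size≤0⇒[] []      _             _ = refl
size≤0⇒[] (a ∷ p) (_ , 0<a ∷ _) h = ⊥-elim (<⇒≱ (≤-trans 0<a (m≤m+n a (size p))) h)

∧₄-false : ∀ {a b c d} → (a ≡ true → b ≡ true → c ≡ true → ⊥) → a ∧ b ∧ c ∧ d ≡ false
∧₄-false {false}               h = refl
∧₄-false {true} {false}        h = refl
∧₄-false {true} {true} {false} h = refl
∧₄-false {true} {true} {true}  h = ⊥-elim (h refl refl refl)

-- Here λ₁ = ν₁ + 1: λ ⊄ ν, and ν⁺/λ has an empty first row, so its μ₁ + 1 ones would lie below it,
-- where column strictness leaves room for only λ₁ ≤ μ₁ of them.
LR-plus-edge : ∀ lam y ys x xs → IsPartition lam → IsPartition (suc x ∷ xs) → part lam 0 ≡ suc x →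
  size lam ≤ y ∸ part ys 0 → LR lam (y ∷ ys) (x ∷ xs) ≡ LR lam (suc y ∷ ys) (suc x ∷ xs)
LR-plus-edge lam y ys x xs plam pnu λ≡x+1 gap =
  trans (if-cong (containedB-false lam x xs (≤-reflexive (sym λ≡x+1))))
        (sym (trans (if-cong-then (containedB lam (suc x ∷ xs)) noTableaux) (if-eta (containedB lam (suc x ∷ xs)))))
  where
  m : ℕ
  m = suc (length ys)
  rest : List (List (List ℕ))
  rest = candidatesFrom lam (suc x ∷ xs) m 1 (length xs)
  empty₀ : length {A = ℕ} [] ≡ suc x ∸ part lam 0
  empty₀ = sym (trans (cong (suc x ∸_) λ≡x+1) (n∸n≡0 (suc x)))

  notLR : ∀ {R} → R ∈ rest → isLR lam (suc y ∷ ys) (suc x ∷ xs) ([] ∷ R) ≡ false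
  notLR {R} R∈ = ∧₄-false λ rw cs ct → <⇒≱ (begin-strict
      suc x          ≡⟨ λ≡x+1 ⟨
      part lam 0     ≤⟨ part₀≤size lam ⟩
      size lam       ≤⟨ gap ⟩
      y ∸ part ys 0  ≤⟨ m∸n≤m y (part ys 0) ⟩
      y              <⟨ n<1+n y ⟩
      suc y          ∎)
    (begin
      suc y                        ≡⟨ contentIs-at (suc y ∷ ys) ([] ∷ R) 0 ct (s≤s z≤n) ⟨
      count 1 (concat ([] ∷ R))    ≤⟨ count-below lam (suc x ∷ xs) ([] ∷ R) 0 0 R plam pnu
                                        (isSSYT lam (suc x ∷ xs) [] R cs rw empty₀ (proj₁ (∈-candidatesFrom⁻ lam (suc x ∷ xs) m 1 (length xs) R∈)))
                                        refl refl ⟩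
      part lam 0 + 0               ≡⟨ trans (+-identityʳ _) λ≡x+1 ⟩
      suc x                        ∎)
    where open ≤-Reasoning

  noTableaux : countBy (isLR lam (suc y ∷ ys) (suc x ∷ xs)) (candidates lam (suc x ∷ xs) m) ≡ 0
  noTableaux = begin
    countBy (isLR lam (suc y ∷ ys) (suc x ∷ xs)) (candidates lam (suc x ∷ xs) m)
      ≡⟨ countBy-isLR-candidates lam (suc y) ys (suc x) xs ⟩
    countBy (λ R → isLR lam (suc y ∷ ys) (suc x ∷ xs) (replicate (suc x ∸ part lam 0) 1 ∷ R)) rest
      ≡⟨ cong (λ k → countBy (λ R → isLR lam (suc y ∷ ys) (suc x ∷ xs) (replicate k 1 ∷ R)) rest) (sym empty₀) ⟩
    countBy (λ R → isLR lam (suc y ∷ ys) (suc x ∷ xs) ([] ∷ R)) rest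
      ≡⟨ countBy-cong _ (λ _ → false) rest notLR ⟩
    countBy (λ _ → false) rest
      ≡⟨ countBy-none _ rest (λ _ → refl) ⟩
    0 ∎
    where open ≡-Reasoning

LR-plus-uncontained : ∀ lam y ys x xs → suc x < part lam 0 → LR lam (y ∷ ys) (x ∷ xs) ≡ LR lam (suc y ∷ ys) (suc x ∷ xs)
LR-plus-uncontained lam y ys x xs x+1<λ =
  trans (if-cong (containedB-false lam x xs (<-trans (n<1+n x) x+1<λ)))
        (sym (if-cong (containedB-false lam (suc x) xs x+1<λ)))

LR-plus-νgap : ∀ lam y ys x xs → IsPartition lam → IsPartition (x ∷ xs) →
  size lam ≤ x ∸ part xs 0 → LR lam (y ∷ ys) (x ∷ xs) ≡ LR lam (suc y ∷ ys) (suc x ∷ xs)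
LR-plus-νgap lam y ys x xs plam pnu gap =
  LR-plus lam y ys x xs pnu (≤-trans (part₀≤size lam) (≤-trans gap (m∸n≤m x (part xs 0))))
          (twosBound-νgap lam (y ∷ ys) x xs plam pnu gap)

LR-plus-μgap : ∀ lam y ys x xs → IsPartition lam → IsPartition (y ∷ ys) → IsPartition (x ∷ xs) →
  size lam ≤ y ∸ part ys 0 → LR lam (y ∷ ys) (x ∷ xs) ≡ LR lam (suc y ∷ ys) (suc x ∷ xs)
LR-plus-μgap lam y ys x xs plam pmu pnu gap with <-cmp (part lam 0) (suc x)
... | tri< λ≤x _ _ = LR-plus lam y ys x xs pnu (≤-pred λ≤x) (twosBound-μgap lam y ys x xs plam pmu pnu gap)
... | tri≈ _ λ≡x+1 _ = LR-plus-edge lam y ys x xs plam (IsPartition-suc x xs pnu) λ≡x+1 gap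
... | tri> _ _ x+1<λ = LR-plus-uncontained lam y ys x xs x+1<λ

LR-row : ∀ a → LR (a ∷ []) [] (a ∷ []) ≡ 1
LR-row a rewrite n∸n≡0 a | ≤⇒≤ᵇ≡true (≤-refl {a}) = refl

LR-row-1 : ∀ a → LR (a ∷ []) (1 ∷ []) (suc a ∷ []) ≡ 1
LR-row-1 a rewrite +-∸-assoc 1 (≤-refl {a}) | n∸n≡0 a | ≤⇒≤ᵇ≡true (m≤n⇒m≤1+n (≤-refl {a})) = refl

-- For μ = ∅ the gap forces ν = (|λ|), so both sides are 1 if λ = ν and 0 otherwise.
LR-empty-νgap : ∀ lam nu → IsPartition lam → IsPartition nu → size nu ≡ size lam + 0 →
  size lam ≤ part nu 0 ∸ part nu 1 → LR lam [] nu ≡ LR lam (1 ∷ []) (plus nu)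
LR-empty-νgap lam []       plam pnu sizes gap rewrite size≤0⇒[] lam plam gap = refl
LR-empty-νgap lam (x ∷ xs) plam pnu sizes gap with size≤0⇒[] xs (IsPartition-tail x xs pnu) tail≤0
  where
  open ≤-Reasoning
  tail≤0 : size xs ≤ 0
  tail≤0 = +-cancelˡ-≤ x _ 0 (begin
    x + size xs       ≡⟨ trans sizes (+-identityʳ _) ⟩
    size lam          ≤⟨ gap ⟩
    x ∸ part xs 0     ≤⟨ m∸n≤m x (part xs 0) ⟩
    x                 ≡⟨ +-identityʳ x ⟨
    x + 0             ∎)
... | refl = single-row lam plam (trans (sym (+-identityʳ x)) (trans sizes (+-identityʳ _)))
  where
  0<x : 0 < x
  0<x = All.head (proj₂ pnu)
  single-row : ∀ lam → IsPartition lam → x ≡ size lam → LR lam [] (x ∷ []) ≡ LR lam (1 ∷ []) (suc x ∷ [])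
  single-row []          _ x≡0   = ⊥-elim (<⇒≢ 0<x (sym x≡0))
  single-row (a ∷ [])    _ x≡a+0 rewrite trans x≡a+0 (+-identityʳ a) = trans (LR-row a) (sym (LR-row-1 a))
  single-row (a ∷ b ∷ l) _ _     = refl

LR-empty-μgap : ∀ lam nu → IsPartition lam → IsPartition nu → size nu ≡ size lam + 0 →
  size lam ≤ 0 → LR lam [] nu ≡ LR lam (1 ∷ []) (plus nu)
LR-empty-μgap lam nu plam pnu sizes gap with size≤0⇒[] lam plam gap
... | refl rewrite size≤0⇒[] nu pnu (≤-reflexive sizes) = refl

lemma3p1 : (lam mu nu : List ℕ) → IsPartition lam → IsPartition mu → IsPartition nu →
    size nu ≡ size lam + size mu →
    (size lam ≤ part nu 0 ∸ part nu 1 → LR lam mu nu ≡ LR lam (plus mu) (plus nu))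
    × (size lam ≤ part mu 0 ∸ part mu 1 → LR lam mu nu ≡ LR lam (plus mu) (plus nu))
lemma3p1 lam [] nu plam pmu pnu sizes = LR-empty-νgap lam nu plam pnu sizes , LR-empty-μgap lam nu plam pnu sizes
lemma3p1 lam (y ∷ ys) [] plam (_ , 0<y ∷ _) pnu sizes =
  ⊥-elim (<⇒≢ (≤-trans 0<y (≤-trans (m≤m+n y (size ys)) (m≤n+m _ (size lam)))) sizes)
lemma3p1 lam (y ∷ ys) (x ∷ xs) plam pmu pnu sizes =
  LR-plus-νgap lam y ys x xs plam pnu , LR-plus-μgap lam y ys x xs plam pmu pnu
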